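{- Let $N \ge 1$ be an integer, let $d$ be an integer with $2 \le d \le 2^N - 1$, and let $n$ be an integer with $0 \le n \le 2^N-1$. Let $p = \lceil \log_2 d \rceil$, $m_{lo} = \lceil 2^{N+p}/d \rceil \bmod 2^N$ and $q = \lfloor m_{lo} n / 2^N \rfloor$. Then $q \le n$ (so the subtraction $n-q$ does not underflow) and $\lfloor (n-q)/2 \rfloor + q \le 2^N - 1$ (so the addition does not overflow); hence $\left\lfloor \frac{\lfloor (n-q)/2 \rfloor + q}{2^{p-1}} \right\rfloor$ can be computed using $N$-bit unsigned registers.
   Context: An $N$-bit unsigned register holds exactly the integers $0,1,\dots,2^N-1$. $p$ is the shift offset and $m_{lo}$ the magic number of the divisor $d$. -}

module Defs where

open import Data.Nat using (ℕ; _+_; _∸_; _^_; NonZero)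
open import Data.Nat.DivMod using (_/_)

⌈_/_⌉ : ℕ → (b : ℕ) → .{{NonZero b}} → ℕ
⌈ a / b ⌉ = (a + (b ∸ 1)) / b

open import Data.Nat.Properties using (m^n≢0)

2^-nonZero : ∀ n → NonZero (2 ^ n)
2^-nonZero n = m^n≢0 2 n

-- With m := mlo < 2 ^ N the quotient q = ⌊m n / 2 ^ N⌋ is at most n, and then
-- ⌊(n − q)/2⌋ + q ≤ (n − q) + q = n ≤ 2 ^ N − 1.  Only mlo < 2 ^ N matters,
-- not the particular value of p or d.
module Submission where

open import Defs
open import Data.Nat using (ℕ; _+_; _*_; _∸_; _^_; _≤_; _<_; NonZero; ⌊_/2⌋)
open import Data.Nat.DivMod using (_/_; _%_; m%n<n; m*n/n≡m; /-monoˡ-≤)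
open import Data.Nat.Logarithm using (⌈log₂_⌉)
open import Data.Nat.Properties
  using (≤-trans; <⇒≤; *-monoˡ-≤; *-comm; +-monoˡ-≤; ⌊n/2⌋≤n; m∸n+n≡m; module ≤-Reasoning)
open import Data.Product using (_×_; _,_)
open import Relation.Binary.PropositionalEquality using (cong)

m*n/o≤n : ∀ m n o .{{_ : NonZero o}} → m ≤ o → m * n / o ≤ n
m*n/o≤n m n o m≤o = begin
  m * n / o  ≤⟨ /-monoˡ-≤ o (*-monoˡ-≤ n m≤o) ⟩
  o * n / o  ≡⟨ cong (_/ o) (*-comm o n) ⟩
  n * o / o  ≡⟨ m*n/n≡m n o ⟩
  n          ∎
  where open ≤-Reasoning

⌊n∸q/2⌋+q≤n : ∀ {n q} → q ≤ n → ⌊ (n ∸ q) /2⌋ + q ≤ n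
⌊n∸q/2⌋+q≤n {n} {q} q≤n = begin
  ⌊ (n ∸ q) /2⌋ + q  ≤⟨ +-monoˡ-≤ q (⌊n/2⌋≤n (n ∸ q)) ⟩
  n ∸ q + q          ≡⟨ m∸n+n≡m q≤n ⟩
  n                  ∎
  where open ≤-Reasoning

proposition3 : (N d n : ℕ) → 1 ≤ N → 2 ≤ d → d ≤ 2 ^ N ∸ 1 → n ≤ 2 ^ N ∸ 1 →
    .{{_ : NonZero d}} →
    let instance _ = 2^-nonZero N
        p = ⌈log₂ d ⌉
        mlo = ⌈ 2 ^ (N + p) / d ⌉ % (2 ^ N)
        q = (mlo * n) / (2 ^ N)
    in q ≤ n × ⌊ (n ∸ q) /2⌋ + q ≤ 2 ^ N ∸ 1
proposition3 N d n _ _ _ n≤2^N∸1 = q≤n , ≤-trans (⌊n∸q/2⌋+q≤n q≤n) n≤2^N∸1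
  where
  instance _ = 2^-nonZero N
  mlo = ⌈ 2 ^ (N + ⌈log₂ d ⌉) / d ⌉ % 2 ^ N
  q≤n : mlo * n / 2 ^ N ≤ n
  q≤n = m*n/o≤n mlo n (2 ^ N) (<⇒≤ (m%n<n _ (2 ^ N)))
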